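{- For all integers $n\ge 0$ and $k$, $$\mathfrak B_{2n}^{(k)}=\sum_{m=0}^n\frac{1}{(2m+1)^k}\sum_{\substack{i_1+\cdots+i_{2m}=n-m\\ i_1,\dots,i_{2m}\ge 0}}\left(-\frac14\right)^{n-m}\binom{2n}{2i_1+1,\dots,2i_{2m}+1},$$ where $\binom{2n}{2i_1+1,\dots,2i_{2m}+1}=\frac{\bigl((2i_1+1)+\cdots+(2i_{2m}+1)\bigr)!}{(2i_1+1)!\cdots(2i_{2m}+1)!}$ is the multinomial coefficient (for $m=0$ the inner sum is over the empty tuple, contributing $1$ if $n=0$ and $0$ otherwise).
   Context: For an integer $k$, the poly-Bernoulli numbers with level $2$, $\mathfrak B_n^{(k)}$, are defined by the power series identity $$\sum_{n=0}^\infty\mathfrak B_n^{(k)}\frac{x^n}{n!}=\frac{{\rm Li}_{2,k}\bigl(2\sin(x/2)\bigr)}{2\sin(x/2)}=\sum_{m=0}^\infty\frac{\bigl(2\sin(x/2)\bigr)^{2m}}{(2m+1)^k},$$ where ${\rm Li}_{2,k}(z)=\sum_{n=0}^\infty\frac{z^{2n+1}}{(2n+1)^k}$. -}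

module Defs where

open import Data.Bool using (if_then_else_)
open import Data.Nat as ℕ using (ℕ; zero; suc; _!; _%_; ⌊_/2⌋; _≡ᵇ_; _∸_; NonZero)
open import Data.Nat.Properties using (_!≢0; m*n≢0)
open import Data.Integer as ℤ using (ℤ; +_; -[1+_])
open import Data.Rational as ℚ using (ℚ; 0ℚ; 1ℚ; _+_; _*_; -_; _/_)
open import Data.List using (List; []; _∷_; [_]; map; concatMap; upTo; foldr)
open import Data.Vec as Vec using (Vec; []; _∷_)

_^ℚ_ : ℚ → ℕ → ℚ
q ^ℚ zero = 1ℚ
q ^ℚ suc n = q * (q ^ℚ n)

ℕ→ℚ : ℕ → ℚ
ℕ→ℚ n = (+ n) / 1

ΣList : List ℚ → ℚ
ΣList = foldr _+_ 0ℚ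

Σ< : ℕ → (ℕ → ℚ) → ℚ
Σ< n f = ΣList (map f (upTo n))

-- formal power series with rational coefficients: n ↦ [x^n]
FPS : Set
FPS = ℕ → ℚ

oneS : FPS
oneS zero = 1ℚ
oneS (suc _) = 0ℚ

_*S_ : FPS → FPS → FPS
(f *S g) n = Σ< (suc n) (λ i → f i * g (n ∸ i))

_^S_ : FPS → ℕ → FPS
f ^S zero = oneS
f ^S suc r = f *S (f ^S r)

-- Taylor coefficients of sin x : [x^(2j+1)] = (-1)^j/(2j+1)!, even coefficients 0
sinS : FPS
sinS n = if (n % 2) ≡ᵇ 1
         then ((- 1ℚ) ^ℚ ⌊ n /2⌋) * ((+ 1) / (n !)) {{n !≢0}}
         else 0ℚ

twoSinHalf : FPS
twoSinHalf n = ℕ→ℚ 2 * (((+ 1) / 2) ^ℚ n) * sinS n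

invPowℤ : (b : ℕ) → .{{NonZero b}} → ℤ → ℚ
invPowℤ b (+ k) = ((+ 1) / (b ℕ.^ k)) {{Data.Nat.Properties.m^n≢0 b k}}
invPowℤ b -[1+ k ] = ℕ→ℚ b ^ℚ suc k

-- poly-Bernoulli numbers of level 2:
-- 𝔅_n^(k) = n! [x^n] Σ_{m≥0} (2 sin(x/2))^(2m)/(2m+1)^k.
-- (2 sin(x/2))^(2m) has order 2m, so only m ≤ n contribute to [x^n];
-- the formal infinite sum over m is therefore the finite sum over m ≤ n.
polyB2 : ℤ → ℕ → ℚ
polyB2 k n = ℕ→ℚ (n !) *
  Σ< (suc n) (λ m → invPowℤ (suc (2 ℕ.* m)) k * (twoSinHalf ^S (2 ℕ.* m)) n)

compositions : (r s : ℕ) → List (Vec ℕ r)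
compositions zero zero = [ [] ]
compositions zero (suc s) = []
compositions (suc r) s =
  concatMap (λ i → map (i ∷_) (compositions r (s ∸ i))) (upTo (suc s))

odd! : ℕ → ℕ
odd! i = (suc (2 ℕ.* i)) !

prodOdd! : {r : ℕ} → Vec ℕ r → ℕ
prodOdd! [] = 1
prodOdd! (i ∷ v) = odd! i ℕ.* prodOdd! v

prodOdd!≢0 : {r : ℕ} (v : Vec ℕ r) → NonZero (prodOdd! v)
prodOdd!≢0 [] = _
prodOdd!≢0 (i ∷ v) =
  m*n≢0 (odd! i) (prodOdd! v) {{suc (2 ℕ.* i) !≢0}} {{prodOdd!≢0 v}}

multinomialOdd : {r : ℕ} → Vec ℕ r → ℚ
multinomialOdd v =
  ((+ ((Vec.sum (Vec.map (λ i → suc (2 ℕ.* i)) v)) !)) / prodOdd! v) {{prodOdd!≢0 v}}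

{-# OPTIONS --safe #-}
module Submission where

-- 2 sin(x/2) = x · S(x²) with S(y) = Σᵢ (-1/4)ⁱ yⁱ/(2i+1)!, so (2 sin(x/2))^(2m) = x^(2m) S(x²)^(2m).
-- Its x^(2n)-coefficient vanishes for m > n, and for m ≤ n it is the y^(n-m)-coefficient of
-- S^(2m), a sum over compositions i₁+⋯+i_(2m) = n-m of ∏ (-1/4)^(iⱼ)/(2iⱼ+1)!.  Since
-- Σ (2iⱼ+1) = 2m + 2(n-m) = 2n, multiplying by (2n)! turns each product into a multinomial.

open import Defs
open import Algebra using (CommutativeMonoid)
open import Data.Bool using (if_then_else_)
open import Function using (_∘_; id)
import Data.Nat as ℕ
open import Data.Nat using (ℕ; zero; suc; _∸_; NonZero; _≤_; _<_; s≤s; _!; ⌊_/2⌋; _%_)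
import Data.Nat.Properties as ℕP
open import Data.Nat.Properties using (_!≢0)
import Data.Nat.Solver
open import Data.Integer as ℤ using (ℤ; +_)
import Data.Integer.Properties as ℤP
open import Data.Rational using (ℚ; 0ℚ; 1ℚ; _+_; _*_; -_; _/_; toℚᵘ)
import Data.Rational.Properties as ℚP
import Data.Rational.Unnormalised as ℚᵘ
import Data.Rational.Unnormalised.Properties as ℚᵘP
open import Algebra.Properties.CommutativeSemigroup
  (CommutativeMonoid.commutativeSemigroup ℚP.*-1-commutativeMonoid)
  using (x∙yz≈y∙xz; interchange)
open import Data.List using (List; []; _∷_; map; concatMap; upTo; _++_)
import Data.List.Properties as List
open import Data.List.Relation.Unary.All as All using (All; []; _∷_)
import Data.List.Relation.Unary.All.Properties as All
open import Data.Vec as Vec using (Vec; []; _∷_)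
open import Relation.Binary.PropositionalEquality

0*x+y≡y : ∀ x y → 0ℚ * x + y ≡ y
0*x+y≡y x y = trans (cong (_+ y) (ℚP.*-zeroˡ x)) (ℚP.+-identityˡ y)

x*0+0≡0 : ∀ x → x * 0ℚ + 0ℚ ≡ 0ℚ
x*0+0≡0 x = trans (ℚP.+-identityʳ _) (ℚP.*-zeroʳ x)

/-*-/ : ∀ a b c d .{{_ : NonZero b}} .{{_ : NonZero d}} →
        ((+ a) / b) * ((+ c) / d) ≡ ((+ (a ℕ.* c)) / (b ℕ.* d)) {{ℕP.m*n≢0 b d}}
/-*-/ a b@(suc b-1) c d@(suc d-1) = ℚP.toℚᵘ-injective (begin
  toℚᵘ (((+ a) / b) * ((+ c) / d))          ≈⟨ ℚP.toℚᵘ-homo-* ((+ a) / b) ((+ c) / d) ⟩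
  toℚᵘ ((+ a) / b) ℚᵘ.* toℚᵘ ((+ c) / d)   ≈⟨ ℚᵘP.*-cong (ℚP.toℚᵘ-fromℚᵘ (ℚᵘ.mkℚᵘ (+ a) b-1))
                                                          (ℚP.toℚᵘ-fromℚᵘ (ℚᵘ.mkℚᵘ (+ c) d-1)) ⟩
  ℚᵘ.mkℚᵘ (+ a ℤ.* + c) bd-1                ≡⟨ cong (λ z → ℚᵘ.mkℚᵘ z bd-1) (sym (ℤP.pos-* a c)) ⟩
  ℚᵘ.mkℚᵘ (+ (a ℕ.* c)) bd-1                ≈⟨ ℚᵘP.≃-sym (ℚP.toℚᵘ-fromℚᵘ (ℚᵘ.mkℚᵘ (+ (a ℕ.* c)) bd-1)) ⟩
  toℚᵘ ((+ (a ℕ.* c)) / (b ℕ.* d))         ∎)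
  where
  open ℚᵘP.≃-Reasoning
  bd-1 : ℕ
  bd-1 = ℕ.pred (b ℕ.* d)

open ≡-Reasoning

^ℚ-distribˡ-+-* : ∀ a i j → a ^ℚ (i ℕ.+ j) ≡ (a ^ℚ i) * (a ^ℚ j)
^ℚ-distribˡ-+-* a zero    j = sym (ℚP.*-identityˡ _)
^ℚ-distribˡ-+-* a (suc i) j = trans (cong (a *_) (^ℚ-distribˡ-+-* a i j)) (sym (ℚP.*-assoc a _ _))

^ℚ-distribʳ-* : ∀ a b i → (a * b) ^ℚ i ≡ (a ^ℚ i) * (b ^ℚ i)
^ℚ-distribʳ-* a b zero    = refl
^ℚ-distribʳ-* a b (suc i) = trans (cong ((a * b) *_) (^ℚ-distribʳ-* a b i)) (interchange a b (a ^ℚ i) (b ^ℚ i))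

^ℚ-2* : ∀ a i → a ^ℚ (2 ℕ.* i) ≡ (a * a) ^ℚ i
^ℚ-2* a zero    = refl
^ℚ-2* a (suc i) = begin
  a ^ℚ (2 ℕ.* suc i)          ≡⟨ cong (a ^ℚ_) (ℕP.*-suc 2 i) ⟩
  a * (a * a ^ℚ (2 ℕ.* i))    ≡⟨ ℚP.*-assoc a a _ ⟨
  a * a * a ^ℚ (2 ℕ.* i)      ≡⟨ cong (a * a *_) (^ℚ-2* a i) ⟩
  (a * a) ^ℚ suc i            ∎

-- Finite sums

ΣList-++ : ∀ xs ys → ΣList (xs ++ ys) ≡ ΣList xs + ΣList ys
ΣList-++ []       ys = sym (ℚP.+-identityˡ _)
ΣList-++ (x ∷ xs) ys = trans (cong (_+_ x) (ΣList-++ xs ys)) (sym (ℚP.+-assoc x _ _))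

ΣList-concatMap : ∀ {A B : Set} (φ : B → ℚ) (F : A → List B) xs →
                  ΣList (map φ (concatMap F xs)) ≡ ΣList (map (λ x → ΣList (map φ (F x))) xs)
ΣList-concatMap φ F []       = refl
ΣList-concatMap φ F (x ∷ xs) = begin
  ΣList (map φ (F x ++ concatMap F xs))           ≡⟨ cong ΣList (List.map-++ φ (F x) _) ⟩
  ΣList (map φ (F x) ++ map φ (concatMap F xs))   ≡⟨ ΣList-++ (map φ (F x)) _ ⟩
  ΣList (map φ (F x)) + ΣList (map φ (concatMap F xs))
    ≡⟨ cong (_+_ (ΣList (map φ (F x)))) (ΣList-concatMap φ F xs) ⟩
  ΣList (map (λ x → ΣList (map φ (F x))) (x ∷ xs)) ∎

*-distribˡ-ΣList : ∀ {A : Set} c (φ : A → ℚ) xs → c * ΣList (map φ xs) ≡ ΣList (map (λ x → c * φ x) xs)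
*-distribˡ-ΣList c φ []       = ℚP.*-zeroʳ c
*-distribˡ-ΣList c φ (x ∷ xs) =
  trans (ℚP.*-distribˡ-+ c (φ x) _) (cong (_+_ (c * φ x)) (*-distribˡ-ΣList c φ xs))

Σ<-suc : ∀ n (f : ℕ → ℚ) → Σ< (suc n) f ≡ f 0 + Σ< n (f ∘ suc)
Σ<-suc n f = cong (λ xs → f 0 + ΣList xs)
  (trans (List.map-applyUpTo suc f n) (sym (List.map-upTo (f ∘ suc) n)))

Σ<-snoc : ∀ n (f : ℕ → ℚ) → Σ< (suc n) f ≡ Σ< n f + f n
Σ<-snoc zero    f = trans (ℚP.+-identityʳ (f 0)) (sym (ℚP.+-identityˡ (f 0)))
Σ<-snoc (suc n) f = begin
  Σ< (suc (suc n)) f                   ≡⟨ Σ<-suc (suc n) f ⟩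
  f 0 + Σ< (suc n) (f ∘ suc)           ≡⟨ cong (_+_ (f 0)) (Σ<-snoc n (f ∘ suc)) ⟩
  f 0 + (Σ< n (f ∘ suc) + f (suc n))   ≡⟨ ℚP.+-assoc (f 0) _ _ ⟨
  f 0 + Σ< n (f ∘ suc) + f (suc n)     ≡⟨ cong (_+ f (suc n)) (Σ<-suc n f) ⟨
  Σ< (suc n) f + f (suc n)             ∎

Σ<-cong : ∀ n {f g : ℕ → ℚ} → (∀ {i} → i < n → f i ≡ g i) → Σ< n f ≡ Σ< n g
Σ<-cong n f≡g = cong ΣList (List.map-cong-local (All.applyUpTo⁺₁ id n f≡g))

Σ<-0 : ∀ n {f : ℕ → ℚ} → (∀ i → f i ≡ 0ℚ) → Σ< n f ≡ 0ℚ
Σ<-0 zero    f≡0 = refl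
Σ<-0 (suc n) {f} f≡0 = begin
  Σ< (suc n) f            ≡⟨ Σ<-suc n f ⟩
  f 0 + Σ< n (f ∘ suc)    ≡⟨ cong₂ _+_ (f≡0 0) (Σ<-0 n (f≡0 ∘ suc)) ⟩
  0ℚ                      ∎

Σ<-+ : ∀ a b (f : ℕ → ℚ) → Σ< (a ℕ.+ b) f ≡ Σ< a f + Σ< b (f ∘ (a ℕ.+_))
Σ<-+ zero    b f = sym (ℚP.+-identityˡ _)
Σ<-+ (suc a) b f = begin
  Σ< (suc a ℕ.+ b) f                                  ≡⟨ Σ<-suc (a ℕ.+ b) f ⟩
  f 0 + Σ< (a ℕ.+ b) (f ∘ suc)                        ≡⟨ cong (_+_ (f 0)) (Σ<-+ a b (f ∘ suc)) ⟩
  f 0 + (Σ< a (f ∘ suc) + Σ< b (f ∘ (suc a ℕ.+_)))    ≡⟨ ℚP.+-assoc (f 0) _ _ ⟨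
  f 0 + Σ< a (f ∘ suc) + Σ< b (f ∘ (suc a ℕ.+_))      ≡⟨ cong (_+ Σ< b (f ∘ (suc a ℕ.+_))) (Σ<-suc a f) ⟨
  Σ< (suc a) f + Σ< b (f ∘ (suc a ℕ.+_))              ∎

Σ<-vanishing-tail : ∀ a b (f : ℕ → ℚ) → (∀ j → f (a ℕ.+ j) ≡ 0ℚ) → Σ< (a ℕ.+ b) f ≡ Σ< a f
Σ<-vanishing-tail a b f tail≡0 =
  trans (Σ<-+ a b f) (trans (cong (_+_ (Σ< a f)) (Σ<-0 b tail≡0)) (ℚP.+-identityʳ _))

-- Formal power series

*S-cong : ∀ {f f′ g g′ : FPS} → f ≗ f′ → g ≗ g′ → f *S g ≗ f′ *S g′
*S-cong f≗f′ g≗g′ n = Σ<-cong (suc n) (λ {i} _ → cong₂ _*_ (f≗f′ i) (g≗g′ (n ∸ i)))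

^S-cong : ∀ {f g : FPS} r → f ≗ g → f ^S r ≗ g ^S r
^S-cong zero    f≗g = λ _ → refl
^S-cong (suc r) f≗g = *S-cong f≗g (^S-cong r f≗g)

mulX : FPS → FPS
mulX f zero    = 0ℚ
mulX f (suc n) = f n

mulX^ : ℕ → FPS → FPS
mulX^ zero    f = f
mulX^ (suc r) f = mulX (mulX^ r f)

mulX-cong : ∀ {f g} → f ≗ g → mulX f ≗ mulX g
mulX-cong f≗g zero    = refl
mulX-cong f≗g (suc n) = f≗g n

mulX^-cong : ∀ r {f g} → f ≗ g → mulX^ r f ≗ mulX^ r g
mulX^-cong zero    f≗g = f≗g
mulX^-cong (suc r) f≗g = mulX-cong (mulX^-cong r f≗g)

mulX^-below : ∀ r f {N} → N < r → mulX^ r f N ≡ 0ℚ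
mulX^-below (suc r) f {zero}  _         = refl
mulX^-below (suc r) f {suc N} (s≤s N<r) = mulX^-below r f N<r

mulX^-+ : ∀ r f j → mulX^ r f (r ℕ.+ j) ≡ f j
mulX^-+ zero    f j = refl
mulX^-+ (suc r) f j = mulX^-+ r f j

mulX-*S : ∀ f g → mulX f *S g ≗ mulX (f *S g)
mulX-*S f g zero    = 0*x+y≡y (g 0) 0ℚ
mulX-*S f g (suc n) = trans (Σ<-suc (suc n) (λ i → mulX f i * g (suc n ∸ i))) (0*x+y≡y (g (suc n)) _)

*S-mulX : ∀ f g → f *S mulX g ≗ mulX (f *S g)
*S-mulX f g zero    = x*0+0≡0 (f 0)
*S-mulX f g (suc n) = begin
  (f *S mulX g) (suc n)
    ≡⟨ Σ<-snoc (suc n) (λ i → f i * mulX g (suc n ∸ i)) ⟩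
  Σ< (suc n) (λ i → f i * mulX g (suc n ∸ i)) + f (suc n) * mulX g (n ∸ n)
    ≡⟨ cong₂ _+_ (Σ<-cong (suc n) λ {i} i<1+n →
                     cong (λ j → f i * mulX g j) (ℕP.+-∸-assoc 1 (ℕP.≤-pred i<1+n)))
                 (cong (λ j → f (suc n) * mulX g j) (ℕP.n∸n≡0 n)) ⟩
  (f *S g) n + f (suc n) * 0ℚ
    ≡⟨ cong (_+_ ((f *S g) n)) (ℚP.*-zeroʳ (f (suc n))) ⟩
  (f *S g) n + 0ℚ
    ≡⟨ ℚP.+-identityʳ _ ⟩
  (f *S g) n ∎

*S-mulX^ : ∀ r f g → f *S mulX^ r g ≗ mulX^ r (f *S g)
*S-mulX^ zero    f g = λ _ → refl
*S-mulX^ (suc r) f g N = trans (*S-mulX f (mulX^ r g) N) (mulX-cong (*S-mulX^ r f g) N)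

-- atX² a is the coefficient sequence of a(x²).
atX² : FPS → FPS
atX² a zero          = a 0
atX² a (suc zero)    = 0ℚ
atX² a (suc (suc N)) = atX² (a ∘ suc) N

atX²-cong : ∀ {a b} → a ≗ b → atX² a ≗ atX² b
atX²-cong a≗b zero          = a≗b 0
atX²-cong a≗b (suc zero)    = refl
atX²-cong a≗b (suc (suc N)) = atX²-cong (a≗b ∘ suc) N

atX²-2* : ∀ a s → atX² a (2 ℕ.* s) ≡ a s
atX²-2* a zero    = refl
atX²-2* a (suc s) = trans (cong (atX² a) (ℕP.*-suc 2 s)) (atX²-2* (a ∘ suc) s)

atX²-unique : ∀ {a c} → (∀ s → c (2 ℕ.* s) ≡ a s) → (∀ s → c (suc (2 ℕ.* s)) ≡ 0ℚ) → c ≗ atX² a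
atX²-unique even odd zero          = even 0
atX²-unique even odd (suc zero)    = odd 0
atX²-unique {c = c} even odd (suc (suc N)) = atX²-unique {c = c ∘ suc ∘ suc}
  (λ s → trans (cong c (sym (ℕP.*-suc 2 s))) (even (suc s)))
  (λ s → trans (cong (c ∘ suc) (sym (ℕP.*-suc 2 s))) (odd (suc s))) N

atX²-oneS : oneS ≗ atX² oneS
atX²-oneS = atX²-unique even (λ _ → refl)
  where
  even : ∀ s → oneS (2 ℕ.* s) ≡ oneS s
  even zero    = refl
  even (suc s) = cong oneS (ℕP.*-suc 2 s)

atX²-linear : ∀ c f g N → c * atX² f N + atX² g N ≡ atX² (λ s → c * f s + g s) N
atX²-linear c f g zero          = refl
atX²-linear c f g (suc zero)    = x*0+0≡0 c
atX²-linear c f g (suc (suc N)) = atX²-linear c (f ∘ suc) (g ∘ suc) N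

*S-atX² : ∀ a b → atX² a *S atX² b ≗ atX² (a *S b)
*S-atX² a b zero          = refl
*S-atX² a b (suc zero)    = trans (cong₂ _+_ (ℚP.*-zeroʳ (a 0)) (0*x+y≡y (b 0) 0ℚ)) (ℚP.+-identityʳ 0ℚ)
*S-atX² a b (suc (suc N)) = begin
  (atX² a *S atX² b) (suc (suc N))
    ≡⟨ Σ<-suc (suc (suc N)) (λ i → atX² a i * atX² b (suc (suc N) ∸ i)) ⟩
  a 0 * atX² (b ∘ suc) N + Σ< (suc (suc N)) (λ i → atX² a (suc i) * atX² b (suc N ∸ i))
    ≡⟨ cong (_+_ (a 0 * atX² (b ∘ suc) N))
            (trans (Σ<-suc (suc N) (λ i → atX² a (suc i) * atX² b (suc N ∸ i))) (0*x+y≡y (atX² b (suc N)) _)) ⟩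
  a 0 * atX² (b ∘ suc) N + (atX² (a ∘ suc) *S atX² b) N
    ≡⟨ cong (_+_ (a 0 * atX² (b ∘ suc) N)) (*S-atX² (a ∘ suc) b N) ⟩
  a 0 * atX² (b ∘ suc) N + atX² ((a ∘ suc) *S b) N
    ≡⟨ atX²-linear (a 0) (b ∘ suc) ((a ∘ suc) *S b) N ⟩
  atX² (λ s → a 0 * b (suc s) + ((a ∘ suc) *S b) s) N
    ≡⟨ atX²-cong (λ s → sym (Σ<-suc (suc s) (λ i → a i * b (suc s ∸ i)))) N ⟩
  atX² (a *S b) (suc (suc N)) ∎

^S-mulX-atX² : ∀ h r → mulX (atX² h) ^S r ≗ mulX^ r (atX² (h ^S r))
^S-mulX-atX² h zero    = atX²-oneS
^S-mulX-atX² h (suc r) N = begin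
  (mulX (atX² h) *S (mulX (atX² h) ^S r)) N
    ≡⟨ *S-cong {f = mulX (atX² h)} (λ _ → refl) (^S-mulX-atX² h r) N ⟩
  (mulX (atX² h) *S mulX^ r (atX² (h ^S r))) N
    ≡⟨ mulX-*S (atX² h) _ N ⟩
  mulX (atX² h *S mulX^ r (atX² (h ^S r))) N
    ≡⟨ mulX-cong (*S-mulX^ r (atX² h) _) N ⟩
  mulX^ (suc r) (atX² h *S atX² (h ^S r)) N
    ≡⟨ mulX^-cong (suc r) (*S-atX² h (h ^S r)) N ⟩
  mulX^ (suc r) (atX² (h ^S suc r)) N ∎

-- Coefficients of a power as a sum over compositions

∏ : ∀ {r} → (ℕ → ℚ) → Vec ℕ r → ℚ
∏ f []      = 1ℚ
∏ f (i ∷ v) = f i * ∏ f v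

^S-coeff : ∀ f r s → (f ^S r) s ≡ ΣList (map (∏ f) (compositions r s))
^S-coeff f zero    zero    = sym (ℚP.+-identityʳ 1ℚ)
^S-coeff f zero    (suc s) = refl
^S-coeff f (suc r) s = begin
  Σ< (suc s) (λ i → f i * (f ^S r) (s ∸ i))
    ≡⟨ Σ<-cong (suc s) (λ {i} _ → cong (f i *_) (^S-coeff f r (s ∸ i))) ⟩
  Σ< (suc s) (λ i → f i * ΣList (map (∏ f) (compositions r (s ∸ i))))
    ≡⟨ Σ<-cong (suc s) (λ {i} _ → *-distribˡ-ΣList (f i) (∏ f) (compositions r (s ∸ i))) ⟩
  Σ< (suc s) (λ i → ΣList (map (∏ f ∘ (i ∷_)) (compositions r (s ∸ i))))
    ≡⟨ Σ<-cong (suc s) (λ {i} _ → cong ΣList (List.map-∘ (compositions r (s ∸ i)))) ⟩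
  Σ< (suc s) (λ i → ΣList (map (∏ f) (map (i ∷_) (compositions r (s ∸ i)))))
    ≡⟨ ΣList-concatMap (∏ f) (λ i → map (i ∷_) (compositions r (s ∸ i))) (upTo (suc s)) ⟨
  ΣList (map (∏ f) (compositions (suc r) s)) ∎

compositions-sum : ∀ r s → All (λ v → Vec.sum v ≡ s) (compositions r s)
compositions-sum zero    zero    = refl ∷ []
compositions-sum zero    (suc s) = []
compositions-sum (suc r) s =
  All.concat⁺ (All.map⁺ (All.applyUpTo⁺₁ id (suc s) λ {i} i<1+s →
    All.map⁺ (All.map (λ Σv≡s∸i → trans (cong (i ℕ.+_) Σv≡s∸i) (ℕP.m+[n∸m]≡n (ℕP.≤-pred i<1+s)))
                      (compositions-sum r (s ∸ i)))))

-- 2 sin(x/2) = x · sincHalf(x²)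

-¼ : ℚ
-¼ = - ((+ 1) / 4)

sincHalf : ℕ → ℚ
sincHalf i = (-¼ ^ℚ i) * ((+ 1) / odd! i) {{suc (2 ℕ.* i) !≢0}}

[2*i]%2≡0 : ∀ i → (2 ℕ.* i) % 2 ≡ 0
[2*i]%2≡0 zero    = refl
[2*i]%2≡0 (suc i) = trans (cong (_% 2) (ℕP.*-suc 2 i)) ([2*i]%2≡0 i)

[1+2*i]%2≡1 : ∀ i → suc (2 ℕ.* i) % 2 ≡ 1
[1+2*i]%2≡1 zero    = refl
[1+2*i]%2≡1 (suc i) = trans (cong (λ j → suc j % 2) (ℕP.*-suc 2 i)) ([1+2*i]%2≡1 i)

⌊1+2*i/2⌋≡i : ∀ i → ⌊ suc (2 ℕ.* i) /2⌋ ≡ i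
⌊1+2*i/2⌋≡i zero    = refl
⌊1+2*i/2⌋≡i (suc i) = trans (cong (λ j → ⌊ suc j /2⌋) (ℕP.*-suc 2 i)) (cong suc (⌊1+2*i/2⌋≡i i))

twoSinHalf-even : ∀ i → twoSinHalf (2 ℕ.* i) ≡ 0ℚ
twoSinHalf-even i = trans (cong (ℕ→ℚ 2 * ½^[2i] *_) sinS-even) (ℚP.*-zeroʳ (ℕ→ℚ 2 * ½^[2i]))
  where
  ½^[2i] : ℚ
  ½^[2i] = ((+ 1) / 2) ^ℚ (2 ℕ.* i)
  sinS-even : sinS (2 ℕ.* i) ≡ 0ℚ
  sinS-even = cong (λ r → if (r ℕ.≡ᵇ 1)
                          then (- 1ℚ) ^ℚ ⌊ 2 ℕ.* i /2⌋ * ((+ 1) / (2 ℕ.* i) !) {{2 ℕ.* i !≢0}}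
                          else 0ℚ)
                   ([2*i]%2≡0 i)

twoSinHalf-odd : ∀ i → twoSinHalf (suc (2 ℕ.* i)) ≡ sincHalf i
twoSinHalf-odd i = begin
  ℕ→ℚ 2 * (½ * ½ ^ℚ (2 ℕ.* i)) * sinS (suc (2 ℕ.* i))
    ≡⟨ cong₂ _*_ two*½^[1+2i]≡¼^i sinS-odd ⟩
  ¼ ^ℚ i * ((- 1ℚ) ^ℚ i * X)
    ≡⟨ ℚP.*-assoc (¼ ^ℚ i) _ X ⟨
  ¼ ^ℚ i * (- 1ℚ) ^ℚ i * X
    ≡⟨ cong (_* X) (sym (^ℚ-distribʳ-* ¼ (- 1ℚ) i)) ⟩
  sincHalf i ∎
  where
  ½ ¼ X : ℚ
  ½ = (+ 1) / 2
  ¼ = (+ 1) / 4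
  X = ((+ 1) / odd! i) {{suc (2 ℕ.* i) !≢0}}
  two*½^[1+2i]≡¼^i : ℕ→ℚ 2 * (½ * ½ ^ℚ (2 ℕ.* i)) ≡ ¼ ^ℚ i
  two*½^[1+2i]≡¼^i = begin
    ℕ→ℚ 2 * (½ * ½ ^ℚ (2 ℕ.* i))  ≡⟨ ℚP.*-assoc (ℕ→ℚ 2) ½ (½ ^ℚ (2 ℕ.* i)) ⟨
    1ℚ * ½ ^ℚ (2 ℕ.* i)           ≡⟨ ℚP.*-identityˡ _ ⟩
    ½ ^ℚ (2 ℕ.* i)                ≡⟨ ^ℚ-2* ½ i ⟩
    ¼ ^ℚ i                        ∎
  sinS-odd : sinS (suc (2 ℕ.* i)) ≡ (- 1ℚ) ^ℚ i * X
  sinS-odd = begin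
    sinS (suc (2 ℕ.* i))
      ≡⟨ cong (λ r → if (r ℕ.≡ᵇ 1) then (- 1ℚ) ^ℚ ⌊ suc (2 ℕ.* i) /2⌋ * X else 0ℚ) ([1+2*i]%2≡1 i) ⟩
    (- 1ℚ) ^ℚ ⌊ suc (2 ℕ.* i) /2⌋ * X
      ≡⟨ cong (λ j → (- 1ℚ) ^ℚ j * X) (⌊1+2*i/2⌋≡i i) ⟩
    (- 1ℚ) ^ℚ i * X ∎

twoSinHalf≗mulX-atX²-sincHalf : twoSinHalf ≗ mulX (atX² sincHalf)
twoSinHalf≗mulX-atX²-sincHalf zero    = twoSinHalf-even 0
twoSinHalf≗mulX-atX²-sincHalf (suc N) = atX²-unique {c = twoSinHalf ∘ suc} twoSinHalf-odd
  (λ s → trans (cong twoSinHalf (sym (ℕP.*-suc 2 s))) (twoSinHalf-even (suc s))) N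

twoSinHalf^≗mulX^-atX² : ∀ r → twoSinHalf ^S r ≗ mulX^ r (atX² (sincHalf ^S r))
twoSinHalf^≗mulX^-atX² r N =
  trans (^S-cong r twoSinHalf≗mulX-atX²-sincHalf N) (^S-mulX-atX² sincHalf r N)

twoSinHalf^-below : ∀ r {N} → N < r → (twoSinHalf ^S r) N ≡ 0ℚ
twoSinHalf^-below r {N} N<r =
  trans (twoSinHalf^≗mulX^-atX² r N) (mulX^-below r (atX² (sincHalf ^S r)) N<r)

-- From products of sincHalf to multinomial coefficients

2*-split : ∀ {m n} → m ≤ n → 2 ℕ.* n ≡ 2 ℕ.* m ℕ.+ 2 ℕ.* (n ∸ m)
2*-split {m} {n} m≤n = trans (cong (2 ℕ.*_) (sym (ℕP.m+[n∸m]≡n m≤n))) (ℕP.*-distribˡ-+ 2 m (n ∸ m))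

sum-map-odd : ∀ {r} (v : Vec ℕ r) → Vec.sum (Vec.map (λ i → suc (2 ℕ.* i)) v) ≡ r ℕ.+ 2 ℕ.* Vec.sum v
sum-map-odd []              = refl
sum-map-odd {suc r} (i ∷ v) =
  trans (cong (λ t → suc (2 ℕ.* i ℕ.+ t)) (sum-map-odd v)) (cong suc (regroup i r (Vec.sum v)))
  where
  open Data.Nat.Solver.+-*-Solver
  regroup : ∀ i r s → 2 ℕ.* i ℕ.+ (r ℕ.+ 2 ℕ.* s) ≡ r ℕ.+ 2 ℕ.* (i ℕ.+ s)
  regroup = solve 3 (λ i r s → con 2 :* i :+ (r :+ con 2 :* s) := r :+ con 2 :* (i :+ s)) refl

∏-sincHalf : ∀ {r} (v : Vec ℕ r) → ∏ sincHalf v ≡ -¼ ^ℚ Vec.sum v * ((+ 1) / prodOdd! v) {{prodOdd!≢0 v}}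
∏-sincHalf []      = refl
∏-sincHalf (i ∷ v) = begin
  sincHalf i * ∏ sincHalf v
    ≡⟨ cong (sincHalf i *_) (∏-sincHalf v) ⟩
  -¼ ^ℚ i * ((+ 1) / odd! i) * (-¼ ^ℚ Vec.sum v * ((+ 1) / prodOdd! v))
    ≡⟨ interchange (-¼ ^ℚ i) _ (-¼ ^ℚ Vec.sum v) _ ⟩
  -¼ ^ℚ i * -¼ ^ℚ Vec.sum v * ((+ 1) / odd! i * ((+ 1) / prodOdd! v))
    ≡⟨ cong₂ _*_ (sym (^ℚ-distribˡ-+-* -¼ i (Vec.sum v)))
                 (/-*-/ 1 (odd! i) 1 (prodOdd! v)) ⟩
  -¼ ^ℚ Vec.sum (i ∷ v) * ((+ 1) / prodOdd! (i ∷ v)) ∎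
  where
  instance
    _ : NonZero (odd! i)
    _ = suc (2 ℕ.* i) !≢0
    _ : NonZero (prodOdd! v)
    _ = prodOdd!≢0 v
    _ : NonZero (prodOdd! (i ∷ v))
    _ = prodOdd!≢0 (i ∷ v)

[2n]!*∏-sincHalf : ∀ {m n} → m ≤ n → (v : Vec ℕ (2 ℕ.* m)) → Vec.sum v ≡ n ∸ m →
                   ℕ→ℚ ((2 ℕ.* n) !) * ∏ sincHalf v ≡ (-¼ ^ℚ (n ∸ m)) * multinomialOdd v
[2n]!*∏-sincHalf {m} {n} m≤n v Σv≡n∸m = begin
  ℕ→ℚ ((2 ℕ.* n) !) * ∏ sincHalf v
    ≡⟨ cong (ℕ→ℚ ((2 ℕ.* n) !) *_) (∏-sincHalf v) ⟩
  ℕ→ℚ ((2 ℕ.* n) !) * (-¼ ^ℚ Vec.sum v * ((+ 1) / prodOdd! v))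
    ≡⟨ x∙yz≈y∙xz (ℕ→ℚ ((2 ℕ.* n) !)) (-¼ ^ℚ Vec.sum v) _ ⟩
  -¼ ^ℚ Vec.sum v * (ℕ→ℚ ((2 ℕ.* n) !) * ((+ 1) / prodOdd! v))
    ≡⟨ cong₂ _*_ (cong (-¼ ^ℚ_) Σv≡n∸m) (/-*-/ ((2 ℕ.* n) !) 1 1 (prodOdd! v)) ⟩
  -¼ ^ℚ (n ∸ m) * ((+ ((2 ℕ.* n) ! ℕ.* 1)) / (1 ℕ.* prodOdd! v)) {{ℕP.m*n≢0 1 (prodOdd! v)}}
    ≡⟨ cong (-¼ ^ℚ (n ∸ m) *_) (ℚP./-cong {{ℕP.m*n≢0 1 (prodOdd! v)}}
                                           (cong +_ [2n]!*1≡[Σodd]!) (ℕP.*-identityˡ _)) ⟩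
  -¼ ^ℚ (n ∸ m) * multinomialOdd v ∎
  where
  instance
    _ : NonZero (prodOdd! v)
    _ = prodOdd!≢0 v
  [2n]!*1≡[Σodd]! : (2 ℕ.* n) ! ℕ.* 1 ≡ Vec.sum (Vec.map (λ i → suc (2 ℕ.* i)) v) !
  [2n]!*1≡[Σodd]! = trans (ℕP.*-identityʳ _) (cong _! (begin
    2 ℕ.* n                          ≡⟨ 2*-split m≤n ⟩
    2 ℕ.* m ℕ.+ 2 ℕ.* (n ∸ m)        ≡⟨ cong (λ s → 2 ℕ.* m ℕ.+ 2 ℕ.* s) Σv≡n∸m ⟨
    2 ℕ.* m ℕ.+ 2 ℕ.* Vec.sum v      ≡⟨ sum-map-odd v ⟨
    Vec.sum (Vec.map (λ i → suc (2 ℕ.* i)) v) ∎))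

[2n]!*[x^2n]twoSinHalf^2m : ∀ {m n} → m ≤ n →
  ℕ→ℚ ((2 ℕ.* n) !) * (twoSinHalf ^S (2 ℕ.* m)) (2 ℕ.* n) ≡
  ΣList (map (λ v → (-¼ ^ℚ (n ∸ m)) * multinomialOdd v) (compositions (2 ℕ.* m) (n ∸ m)))
[2n]!*[x^2n]twoSinHalf^2m {m} {n} m≤n = begin
  F * (twoSinHalf ^S (2 ℕ.* m)) (2 ℕ.* n)
    ≡⟨ cong (F *_) (twoSinHalf^≗mulX^-atX² (2 ℕ.* m) (2 ℕ.* n)) ⟩
  F * mulX^ (2 ℕ.* m) (atX² (sincHalf ^S (2 ℕ.* m))) (2 ℕ.* n)
    ≡⟨ cong (λ N → F * mulX^ (2 ℕ.* m) (atX² (sincHalf ^S (2 ℕ.* m))) N) (2*-split m≤n) ⟩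
  F * mulX^ (2 ℕ.* m) (atX² (sincHalf ^S (2 ℕ.* m))) (2 ℕ.* m ℕ.+ 2 ℕ.* (n ∸ m))
    ≡⟨ cong (F *_) (trans (mulX^-+ (2 ℕ.* m) _ (2 ℕ.* (n ∸ m))) (atX²-2* (sincHalf ^S (2 ℕ.* m)) (n ∸ m))) ⟩
  F * (sincHalf ^S (2 ℕ.* m)) (n ∸ m)
    ≡⟨ cong (F *_) (^S-coeff sincHalf (2 ℕ.* m) (n ∸ m)) ⟩
  F * ΣList (map (∏ sincHalf) (compositions (2 ℕ.* m) (n ∸ m)))
    ≡⟨ *-distribˡ-ΣList F (∏ sincHalf) (compositions (2 ℕ.* m) (n ∸ m)) ⟩
  ΣList (map (λ v → F * ∏ sincHalf v) (compositions (2 ℕ.* m) (n ∸ m)))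
    ≡⟨ cong ΣList (List.map-cong-local (All.map (λ {v} → [2n]!*∏-sincHalf m≤n v)
                                                 (compositions-sum (2 ℕ.* m) (n ∸ m)))) ⟩
  ΣList (map (λ v → (-¼ ^ℚ (n ∸ m)) * multinomialOdd v) (compositions (2 ℕ.* m) (n ∸ m))) ∎
  where
  F : ℚ
  F = ℕ→ℚ ((2 ℕ.* n) !)

theorem5 : (n : ℕ) (k : ℤ) →
    polyB2 k (2 Data.Nat.* n) ≡
      Σ< (suc n) (λ m → invPowℤ (suc (2 Data.Nat.* m)) k *
        ΣList (map (λ v → ((- ((+ 1) / 4)) ^ℚ (n ∸ m)) * multinomialOdd v)
                   (compositions (2 Data.Nat.* m) (n ∸ m))))
theorem5 n k = begin
  polyB2 k (2 ℕ.* n)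
    ≡⟨⟩
  F * Σ< (suc n ℕ.+ (n ℕ.+ 0)) term
    ≡⟨ cong (F *_) (Σ<-vanishing-tail (suc n) (n ℕ.+ 0) term vanishing) ⟩
  F * Σ< (suc n) term
    ≡⟨ *-distribˡ-ΣList F term (upTo (suc n)) ⟩
  Σ< (suc n) (λ m → F * term m)
    ≡⟨ Σ<-cong (suc n) (λ {m} m<1+n → trans (x∙yz≈y∙xz F (c m) _)
                                            (cong (c m *_) ([2n]!*[x^2n]twoSinHalf^2m (ℕP.≤-pred m<1+n)))) ⟩
  Σ< (suc n) (λ m → c m * ΣList (map (λ v → (-¼ ^ℚ (n ∸ m)) * multinomialOdd v)
                                     (compositions (2 ℕ.* m) (n ∸ m)))) ∎
  where
  F : ℚ
  F = ℕ→ℚ ((2 ℕ.* n) !)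
  c : ℕ → ℚ
  c m = invPowℤ (suc (2 ℕ.* m)) k
  term : ℕ → ℚ
  term m = c m * (twoSinHalf ^S (2 ℕ.* m)) (2 ℕ.* n)
  vanishing : ∀ j → term (suc n ℕ.+ j) ≡ 0ℚ
  vanishing j = trans (cong (c (suc n ℕ.+ j) *_) (twoSinHalf^-below (2 ℕ.* (suc n ℕ.+ j))
                                                   (ℕP.*-monoʳ-< 2 (s≤s (ℕP.m≤m+n n j)))))
                      (ℚP.*-zeroʳ (c (suc n ℕ.+ j)))
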